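{- For every odd integer $n\geq 3$ and every integer $d$ with $3\le d\le n$, there exists a symmetric diagonal Kotzig array of order $d\times n$.
   Context: For an integer $a$ and a positive integer $n$, $\langle a\rangle_n$ denotes the unique element of $\{1,\dots,n\}$ congruent to $a$ modulo $n$. For a $d\times n$ array $A=(a_{i,j})$ ($i\in\{1,\dots,d\}$, $j\in\{1,\dots,n\}$), the forward diagonals are, for each $j\in\{1,\dots,n\}$, the sets of entries $\{a_{i,\langle j+i\rangle_n}: i=1,\dots,d\}$. A $d\times n$ array $A=(a_{i,j})$ with $d\le n$ is a symmetric diagonal Kotzig array if: (1) each row is a permutation of $\{1,\dots,n\}$; (2) all columns have the same sum; (3) all forward diagonals have the same sum; (4) $a_{i,j}+a_{d+1-i,n+1-j}=n+1$ for all $i,j$. -}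

module Defs where

open import Data.Nat using (ℕ; zero; suc; _+_; _∸_; _%_; NonZero)
open import Data.Fin using (Fin; toℕ; fromℕ<; opposite)
open import Data.Nat.DivMod using (m%n<n)
open import Data.Fin.Permutation using (Permutation′; _⟨$⟩ʳ_)
open import Data.Product using (Σ; _×_)
open import Relation.Binary.PropositionalEquality using (_≡_)

Σ[_] : (k : ℕ) → (Fin k → ℕ) → ℕ
Σ[ zero ] f = 0
Σ[ suc k ] f = f Fin.zero + Σ[ k ] (λ i → f (Fin.suc i))

-- A d × n array with natural-number entries.  Row index i : Fin d stands for
-- the 1-based row (toℕ i + 1); column index j : Fin n for column (toℕ j + 1).
Array : ℕ → ℕ → Set
Array d n = Fin d → Fin n → ℕ

-- ⟨a⟩_n for a ≥ 1, as 0-based Fin index: ⟨a⟩_n - 1 = (a - 1) mod n.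
-- The forward diagonal j (1-based j = toℕ j' + 1) consists of the entries
-- a_{i, ⟨j + i⟩_n}, i = 1..d.
diagCol : (n : ℕ) .{{_ : NonZero n}} → ℕ → ℕ → Fin n
diagCol n i' j' = fromℕ< (m%n<n (j' + i' + 1) n)

RowsArePermutations : (d n : ℕ) → Array d n → Set
RowsArePermutations d n A =
  (i : Fin d) → Σ (Permutation′ n) λ π → (j : Fin n) → A i j ≡ suc (toℕ (π ⟨$⟩ʳ j))

EqualColumnSums : (d n : ℕ) → Array d n → Set
EqualColumnSums d n A = (j k : Fin n) → Σ[ d ] (λ i → A i j) ≡ Σ[ d ] (λ i → A i k)

EqualDiagonalSums : (d n : ℕ) .{{_ : NonZero n}} → Array d n → Set
EqualDiagonalSums d n A =
  (j k : Fin n) →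
  Σ[ d ] (λ i → A i (diagCol n (toℕ i) (toℕ j)))
    ≡ Σ[ d ] (λ i → A i (diagCol n (toℕ i) (toℕ k)))

Symmetric : (d n : ℕ) → Array d n → Set
Symmetric d n A =
  (i : Fin d) (j : Fin n) → A i j + A (opposite i) (opposite j) ≡ n + 1

IsSymmetricDiagonalKotzig : (d n : ℕ) .{{_ : NonZero n}} → Array d n → Set
IsSymmetricDiagonalKotzig d n A =
  RowsArePermutations d n A × EqualColumnSums d n A
    × EqualDiagonalSums d n A × Symmetric d n A

module Submission where

-- Write n = 2m + 1 and shift all entries down by one, to 0, …, 2m.  Besides the identity and
-- the reflection x ↦ 2m − x, the rows used are rotations x ↦ x + s (mod n) and the zigzag row
-- x ↦ m(x + 1) (mod n).  The zigzag row, its reflected dual and the identity form a 3-row array;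
-- two copies of it give a 6-row array, and two overlapping copies with the shared row replaced
-- by the reflection give a 5-row one.  Any array with k rows grows to k + 4 rows by framing it
-- with two rotations outside and their reflections inside: the rotation amounts are chosen so
-- that the four new rows sum to 2m in pairs along every column and every diagonal, and are dual
-- to each other under the symmetry.

open import Defs
open import Data.Nat using (ℕ; zero; suc; _+_; _*_; _∸_; _≤_; _<_; _%_; NonZero; z≤n; s≤s)
open import Data.Nat.Properties
open import Data.Nat.DivMod
open import Data.Nat.Tactic.RingSolver using (solve-∀)
open import Algebra.Properties.CommutativeSemigroup +-commutativeSemigroup using (x∙yz≈y∙xz)
open import Data.Product using (Σ; _,_; proj₁; proj₂)
open import Data.Sum using (inj₁; inj₂)
open import Data.Fin using (Fin; toℕ; fromℕ<; opposite; punchOut)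
open import Data.Fin.Properties using (toℕ<n; toℕ-fromℕ<; toℕ-injective; opposite-prop; any?; punchOut-injective; injective⇒≤)
  renaming (_≟_ to _≟ᶠ_)
open import Data.Fin.Permutation using (Permutation′; _⟨$⟩ʳ_; permutation)
open import Function using (_∘_; id)
open import Function.Definitions using (Injective)
open import Relation.Nullary using (yes; no; contradiction)
open import Relation.Binary.PropositionalEquality
open ≡-Reasoning

sumBelow : ℕ → (ℕ → ℕ) → ℕ
sumBelow zero    f = 0
sumBelow (suc k) f = f 0 + sumBelow k (f ∘ suc)

sumBelow-cong : ∀ k {f g : ℕ → ℕ} → (∀ i → f i ≡ g i) → sumBelow k f ≡ sumBelow k g
sumBelow-cong zero    f≗g = refl
sumBelow-cong (suc k) f≗g = cong₂ _+_ (f≗g 0) (sumBelow-cong k (f≗g ∘ suc))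

sumBelow-+ : ∀ k l f → sumBelow (k + l) f ≡ sumBelow k f + sumBelow l (f ∘ (k +_))
sumBelow-+ zero    l f = refl
sumBelow-+ (suc k) l f =
  trans (cong (f 0 +_) (sumBelow-+ k l (f ∘ suc))) (sym (+-assoc (f 0) _ _))

sumBelow-suc : ∀ k f → sumBelow k (suc ∘ f) ≡ k + sumBelow k f
sumBelow-suc zero    f = refl
sumBelow-suc (suc k) f =
  cong suc (trans (cong (f 0 +_) (sumBelow-suc k (f ∘ suc))) (x∙yz≈y∙xz (f 0) k _))

m+n≡o⇒o∸m≡n : ∀ m {n o} → m + n ≡ o → o ∸ m ≡ n
m+n≡o⇒o∸m≡n m {n} refl = m+n∸m≡n m n

data EvenOrOdd : ℕ → Set where
  even : ∀ t → EvenOrOdd (t + t)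
  odd  : ∀ t → EvenOrOdd (suc (t + t))

evenOrOdd : ∀ x → EvenOrOdd x
evenOrOdd zero = even 0
evenOrOdd (suc x) with evenOrOdd x
... | even t = odd t
... | odd t  = subst EvenOrOdd (cong suc (+-suc t t)) (even (suc t))

m+m≤n+n⇒m≤n : ∀ {m n} → m + m ≤ n + n → m ≤ n
m+m≤n+n⇒m≤n m+m≤n+n = ≮⇒≥ λ n<m → <⇒≱ (+-mono-< n<m n<m) m+m≤n+n

1+m+m≤n+n⇒m<n : ∀ {m n} → suc (m + m) ≤ n + n → m < n
1+m+m≤n+n⇒m<n m+m<n+n = ≰⇒> λ n≤m → <⇒≱ m+m<n+n (+-mono-≤ n≤m n≤m)

-- zigzag m x ≡ m(x + 1) mod (2m + 1): it runs m, 2m, m − 1, 2m − 1, …, m + 1, 0.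
zigzag : ℕ → ℕ → ℕ
zigzag m zero          = m
zigzag m (suc zero)    = m + m
zigzag m (suc (suc x)) = zigzag m x ∸ 1

zigzag-skip : ∀ m t x → zigzag m (t + t + x) ≡ zigzag m x ∸ t
zigzag-skip m zero    x = refl
zigzag-skip m (suc t) x = begin
  zigzag m (suc (t + suc t + x))   ≡⟨ cong (λ y → zigzag m (suc (y + x))) (+-suc t t) ⟩
  zigzag m (t + t + x) ∸ 1         ≡⟨ cong (_∸ 1) (zigzag-skip m t x) ⟩
  zigzag m x ∸ t ∸ 1               ≡⟨ ∸-+-assoc (zigzag m x) t 1 ⟩
  zigzag m x ∸ (t + 1)             ≡⟨ cong (zigzag m x ∸_) (+-comm t 1) ⟩
  zigzag m x ∸ suc t               ∎

zigzag-even : ∀ m t → zigzag m (t + t) ≡ m ∸ t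
zigzag-even m t = trans (cong (zigzag m) (sym (+-identityʳ (t + t)))) (zigzag-skip m t 0)

zigzag-odd : ∀ m t → zigzag m (suc (t + t)) ≡ (m + m) ∸ t
zigzag-odd m t = trans (cong (zigzag m) (+-comm 1 (t + t))) (zigzag-skip m t 1)

zigzag-≤ : ∀ m x → zigzag m x ≤ m + m
zigzag-≤ m zero          = m≤m+n m m
zigzag-≤ m (suc zero)    = ≤-refl
zigzag-≤ m (suc (suc x)) = ≤-trans (m∸n≤m (zigzag m x) 1) (zigzag-≤ m x)

zigzag-even<odd : ∀ m t s → suc (s + s) ≤ m + m → zigzag m (t + t) < zigzag m (suc (s + s))
zigzag-even<odd m t s le = subst₂ _<_ (sym (zigzag-even m t)) (sym (zigzag-odd m s))
  (≤-<-trans (m∸n≤m m t) (m+n≤o⇒m≤o∸n (suc m) (+-monoʳ-< m (1+m+m≤n+n⇒m<n {s} {m} le))))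

zigzag-injective : ∀ m {x y} → x ≤ m + m → y ≤ m + m → zigzag m x ≡ zigzag m y → x ≡ y
zigzag-injective m {x} {y} x≤ y≤ eq with evenOrOdd x | evenOrOdd y
... | even t | even s = cong (λ u → u + u)
  (∸-cancelˡ-≡ (m+m≤n+n⇒m≤n {t} {m} x≤) (m+m≤n+n⇒m≤n {s} {m} y≤)
    (trans (sym (zigzag-even m t)) (trans eq (zigzag-even m s))))
... | odd t  | odd s  = cong (λ u → suc (u + u))
  (∸-cancelˡ-≡ (≤-trans (m≤m+n t t) (<⇒≤ x≤)) (≤-trans (m≤m+n s s) (<⇒≤ y≤))
    (trans (sym (zigzag-odd m t)) (trans eq (zigzag-odd m s))))
... | even t | odd s  = contradiction eq (<⇒≢ (zigzag-even<odd m t s y≤))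
... | odd t  | even s = contradiction (sym eq) (<⇒≢ (zigzag-even<odd m s t x≤))

zigzag-positive : ∀ m {x} → suc (suc x) ≤ m + m → 0 < zigzag m x
zigzag-positive m {x} le with evenOrOdd x
... | even t = subst (0 <_) (sym (zigzag-even m t))
  (m<n⇒0<n∸m (m+m≤n+n⇒m≤n {suc t} {m} (subst (_≤ m + m) (cong suc (sym (+-suc t t))) le)))
... | odd t  = subst (0 <_) (sym (zigzag-odd m t))
  (m<n⇒0<n∸m (≤-trans (s≤s (m≤m+n t t)) (≤-trans (n≤1+n _) (≤-trans (n≤1+n _) le))))

zigzag-reflect : ∀ m {x} → x ≤ m + m → zigzag m x + x + m ≡ zigzag m ((m + m) ∸ x) + (m + m)
zigzag-reflect m {x} x≤ with evenOrOdd x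
... | even t with u , refl ← m≤n⇒∃[o]m+o≡n {t} {m} (m+m≤n+n⇒m≤n x≤) = begin
  zigzag (t + u) (t + t) + (t + t) + (t + u)
    ≡⟨ cong (λ z → z + (t + t) + (t + u)) (trans (zigzag-even (t + u) t) (m+n∸m≡n t u)) ⟩
  u + (t + t) + (t + u)
    ≡⟨ lemma t u ⟩
  t + ((t + u) + (t + u))
    ≡⟨ cong (_+ ((t + u) + (t + u))) (trans (sym (m+n∸n≡m t u)) (sym (zigzag-even (t + u) u))) ⟩
  zigzag (t + u) (u + u) + ((t + u) + (t + u))
    ≡⟨ cong (λ y → zigzag (t + u) y + ((t + u) + (t + u))) (m+n≡o⇒o∸m≡n (t + t) (lemma₂ t u)) ⟨
  zigzag (t + u) ((t + u) + (t + u) ∸ (t + t)) + ((t + u) + (t + u)) ∎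
  where
  lemma : ∀ t u → u + (t + t) + (t + u) ≡ t + ((t + u) + (t + u))
  lemma = solve-∀
  lemma₂ : ∀ t u → (t + t) + (u + u) ≡ (t + u) + (t + u)
  lemma₂ = solve-∀
... | odd t with u , refl ← m≤n⇒∃[o]m+o≡n {suc t} {m} (1+m+m≤n+n⇒m<n x≤) = begin
  zigzag M (suc (t + t)) + suc (t + t) + M
    ≡⟨ cong (λ z → z + suc (t + t) + M) (trans (zigzag-odd M t) (m+n≡o⇒o∸m≡n t (lemma₁ t u))) ⟩
  suc (suc (t + u + u)) + suc (t + t) + M
    ≡⟨ lemma₂ t u ⟩
  suc (suc (t + t + u)) + (M + M)
    ≡⟨ cong (_+ (M + M)) (trans (zigzag-odd M u) (m+n≡o⇒o∸m≡n u (lemma₃ t u))) ⟨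
  zigzag M (suc (u + u)) + (M + M)
    ≡⟨ cong (λ y → zigzag M y + (M + M)) (m+n≡o⇒o∸m≡n (suc (t + t)) (lemma₄ t u)) ⟨
  zigzag M (M + M ∸ suc (t + t)) + (M + M) ∎
  where
  M = suc (t + u)
  lemma₁ : ∀ t u → t + suc (suc (t + u + u)) ≡ suc (t + u) + suc (t + u)
  lemma₁ = solve-∀
  lemma₂ : ∀ t u → suc (suc (t + u + u)) + suc (t + t) + suc (t + u)
                 ≡ suc (suc (t + t + u)) + (suc (t + u) + suc (t + u))
  lemma₂ = solve-∀
  lemma₃ : ∀ t u → u + suc (suc (t + t + u)) ≡ suc (t + u) + suc (t + u)
  lemma₃ = solve-∀
  lemma₄ : ∀ t u → suc (t + t) + suc (u + u) ≡ suc (t + u) + suc (t + u)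
  lemma₄ = solve-∀

-- Only m = 0 needs the case split: there 1 % 1 is 0, and zigzag 0 0 ≡ 0 + 0 as well.
zigzag-1%n : ∀ m → zigzag m (1 % suc (m + m)) ≡ m + m
zigzag-1%n zero    = refl
zigzag-1%n (suc m) = cong (zigzag (suc m)) (m≤n⇒m%n≡m {n = suc m + suc m} (s≤s z≤n))

[m%n+k]%n≡[m+k]%n : ∀ a b n .{{_ : NonZero n}} → (a % n + b) % n ≡ (a + b) % n
[m%n+k]%n≡[m+k]%n a b n = begin
  (a % n + b) % n         ≡⟨ %-distribˡ-+ (a % n) b n ⟩
  (a % n % n + b % n) % n ≡⟨ cong (λ z → (z + b % n) % n) (m%n%n≡m%n a n) ⟩
  (a % n + b % n) % n     ≡⟨ %-distribˡ-+ a b n ⟨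
  (a + b) % n             ∎

[k+m%n]%n≡[k+m]%n : ∀ a b n .{{_ : NonZero n}} → (a + b % n) % n ≡ (a + b) % n
[k+m%n]%n≡[k+m]%n a b n = begin
  (a + b % n) % n ≡⟨ cong (_% n) (+-comm a (b % n)) ⟩
  (b % n + a) % n ≡⟨ [m%n+k]%n≡[m+k]%n b a n ⟩
  (b + a) % n     ≡⟨ cong (_% n) (+-comm b a) ⟩
  (a + b) % n     ∎

Σ[]-toℕ : ∀ d {g : Fin d → ℕ} f → (∀ i → g i ≡ f (toℕ i)) → Σ[ d ] g ≡ sumBelow d f
Σ[]-toℕ zero    f g≗f = refl
Σ[]-toℕ (suc d) f g≗f = cong₂ _+_ (g≗f Fin.zero) (Σ[]-toℕ d (f ∘ suc) (g≗f ∘ Fin.suc))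

injective⇒surjective : ∀ {n} {f : Fin n → Fin n} → Injective _≡_ _≡_ f → ∀ y → Σ (Fin n) (λ x → f x ≡ y)
injective⇒surjective {n} {f} f-injective y with any? (λ x → f x ≟ᶠ y)
... | yes found = found
injective⇒surjective {suc n} {f} f-injective y | no missed =
  contradiction (injective⇒≤ g-injective) 1+n≰n
  where
  g : Fin (suc n) → Fin n
  g x = punchOut {i = y} {j = f x} (λ y≡fx → missed (x , sym y≡fx))
  g-injective : Injective _≡_ _≡_ g
  g-injective {a} {b} = f-injective ∘ punchOut-injective {i = y} (λ y≡fa → missed (a , sym y≡fa))
                                                                 (λ y≡fb → missed (b , sym y≡fb))

injective⇒permutation : ∀ {n} {f : Fin n → Fin n} → Injective _≡_ _≡_ f →
                        Σ (Permutation′ n) (λ π → ∀ i → π ⟨$⟩ʳ i ≡ f i)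
injective⇒permutation {f = f} f-injective =
  permutation f (proj₁ ∘ surjective) (proj₂ ∘ surjective) (λ x → f-injective (proj₂ (surjective (f x)))) ,
  λ _ → refl
  where
  surjective = injective⇒surjective f-injective

module Construction (m : ℕ) where

  top : ℕ
  top = m + m

  N : ℕ
  N = suc top

  Row : Set
  Row = ℕ → ℕ

  Rows : Set
  Rows = ℕ → Row

  reflect : Row
  reflect x = top ∸ x

  dual : Row → Row
  dual f = reflect ∘ f ∘ reflect

  rotate : ℕ → Row
  rotate s x = (x + s) % N

  record IsRow (f : Row) : Set where
    field
      bounded   : ∀ {x} → x ≤ top → f x ≤ top
      injective : ∀ {x y} → x ≤ top → y ≤ top → f x ≡ f y → x ≡ y

  open IsRow

  Dual : Row → Row → Set
  Dual f g = ∀ {x} → x ≤ top → f x + g (reflect x) ≡ top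

  -- Rows and columns are indexed from 0 and entries are the paper's minus one, so that
  -- diagonal j below is the paper's forward diagonal j.
  record IsKotzig (d : ℕ) (G : Rows) : Set where
    field
      rows      : ∀ {i} → i < d → IsRow (G i)
      columns   : ∀ {x} → x ≤ top → sumBelow d (λ i → G i x) ≡ d * m
      diagonals : ∀ j → sumBelow d (λ i → G i ((i + j) % N)) ≡ d * m
      symmetric : ∀ {i} → i < d → Dual (G i) (G (d ∸ suc i))

  %N-small : ∀ {x} → x ≤ top → x % N ≡ x
  %N-small = m≤n⇒m%n≡m

  %N≤top : ∀ x → x % N ≤ top
  %N≤top x = ≤-pred (m%n<n x N)

  reflect-≤ : ∀ x → reflect x ≤ top
  reflect-≤ x = m∸n≤m top x

  reflect-involutive : ∀ {x} → x ≤ top → reflect (reflect x) ≡ x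
  reflect-involutive = m∸[m∸n]≡n

  +-reflect : ∀ {x} → x ≤ top → x + reflect x ≡ top
  +-reflect = m+[n∸m]≡n

  id-row : IsRow id
  id-row = record { bounded = id ; injective = λ _ _ → id }

  reflect-row : IsRow reflect
  reflect-row = record { bounded = λ {x} _ → reflect-≤ x ; injective = ∸-cancelˡ-≡ }

  ∘-row : ∀ {f g} → IsRow f → IsRow g → IsRow (f ∘ g)
  ∘-row f-row g-row = record
    { bounded   = bounded f-row ∘ bounded g-row
    ; injective = λ x≤ y≤ → injective g-row x≤ y≤
                            ∘ injective f-row (bounded g-row x≤) (bounded g-row y≤)
    }

  dual-row : ∀ {f} → IsRow f → IsRow (dual f)
  dual-row f-row = ∘-row reflect-row (∘-row f-row reflect-row)

  zigzag-row : IsRow (zigzag m)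
  zigzag-row = record { bounded = λ {x} _ → zigzag-≤ m x ; injective = zigzag-injective m }

  rotate-inverse : ∀ s {x} → x ≤ top → rotate (s * top) (rotate s x) ≡ x
  rotate-inverse s {x} x≤ = begin
    ((x + s) % N + s * top) % N ≡⟨ [m%n+k]%n≡[m+k]%n (x + s) (s * top) N ⟩
    (x + s + s * top) % N       ≡⟨ cong (_% N) (lemma x s m) ⟩
    (x + s * N) % N             ≡⟨ [m+kn]%n≡m%n x s N ⟩
    x % N                       ≡⟨ %N-small x≤ ⟩
    x                           ∎
    where
    lemma : ∀ x s m → x + s + s * (m + m) ≡ x + s * suc (m + m)
    lemma = solve-∀

  rotate-row : ∀ s → IsRow (rotate s)
  rotate-row s = record
    { bounded   = λ {x} _ → %N≤top (x + s)
    ; injective = λ {x} {y} x≤ y≤ eq →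
        trans (sym (rotate-inverse s x≤)) (trans (cong (rotate (s * top)) eq) (rotate-inverse s y≤))
    }

  id-self-dual : Dual id id
  id-self-dual = +-reflect

  reflect-self-dual : Dual reflect reflect
  reflect-self-dual {x} x≤ = trans (cong (reflect x +_) (reflect-involutive x≤)) (m∸n+n≡m x≤)

  dual-Dualˡ : ∀ {f} → IsRow f → Dual (dual f) f
  dual-Dualˡ f-row {x} _ = m∸n+n≡m (bounded f-row (reflect-≤ x))

  dual-Dualʳ : ∀ {f} → IsRow f → Dual f (dual f)
  dual-Dualʳ {f} f-row {x} x≤ =
    trans (cong (λ y → f x + reflect (f y)) (reflect-involutive x≤)) (+-reflect (bounded f-row x≤))

  reflect-Dual : ∀ f g → Dual f g → Dual (reflect ∘ f) (reflect ∘ g)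
  reflect-Dual f g fg {x} x≤ = begin
    reflect (f x) + reflect (g (reflect x)) ≡⟨ cong₂ _+_ (m+n≡o⇒o∸m≡n (f x) (fg x≤))
                                                         (m+n≡o⇒o∸m≡n (g (reflect x)) (trans (+-comm (g (reflect x)) (f x)) (fg x≤))) ⟩
    g (reflect x) + f x                     ≡⟨ +-comm (g (reflect x)) (f x) ⟩
    f x + g (reflect x)                     ≡⟨ fg x≤ ⟩
    top                                     ∎

  %-unique : ∀ {S} → S % N ≡ top → S ≤ top + top → S ≡ top
  %-unique {S} S%N≡top S≤ with S / N | m≡m%n+[m/n]*n S N
  ... | zero  | S≡ = trans S≡ (trans (+-identityʳ (S % N)) S%N≡top)
  ... | suc c | S≡ = contradiction S≤ (<⇒≱ (<-≤-trans (+-monoʳ-< top (n<1+n top)) top+N≤S))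
    where
    top+N≤S : top + N ≤ S
    top+N≤S = subst (top + N ≤_) (sym (trans S≡ (cong (_+ suc c * N) S%N≡top)))
                    (+-monoʳ-≤ top (m≤m+n N (c * N)))

  %-complement : ∀ a b q → a + b ≡ top + q * N → a % N + b % N ≡ top
  %-complement a b q a+b≡ = %-unique residue (+-mono-≤ (%N≤top a) (%N≤top b))
    where
    residue : (a % N + b % N) % N ≡ top
    residue = begin
      (a % N + b % N) % N ≡⟨ %-distribˡ-+ a b N ⟨
      (a + b) % N         ≡⟨ cong (_% N) a+b≡ ⟩
      (top + q * N) % N   ≡⟨ [m+kn]%n≡m%n top q N ⟩
      top % N             ≡⟨ %N-small ≤-refl ⟩
      top                 ∎

  rotate-Dual : ∀ s t q → s + t ≡ q * N → Dual (rotate s) (rotate t)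
  rotate-Dual s t q s+t≡ {x} x≤ = %-complement (x + s) (reflect x + t) q (begin
    x + s + (reflect x + t)     ≡⟨ lemma x s (reflect x) t ⟩
    (x + reflect x) + (s + t)   ≡⟨ cong₂ _+_ (+-reflect x≤) s+t≡ ⟩
    top + q * N                 ∎)
    where
    lemma : ∀ x s y t → x + s + (y + t) ≡ (x + y) + (s + t)
    lemma = solve-∀

  snoc : ℕ → Rows → Row → Rows
  snoc zero    G g i       = g
  snoc (suc k) G g zero    = G 0
  snoc (suc k) G g (suc i) = snoc k (G ∘ suc) g i

  snoc-< : ∀ k {G g i} → i < k → snoc k G g i ≡ G i
  snoc-< (suc k) {i = zero}  _         = refl
  snoc-< (suc k) {i = suc i} (s≤s i<k) = snoc-< k i<k

  snoc-last : ∀ k {G g} → snoc k G g k ≡ g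
  snoc-last zero    = refl
  snoc-last (suc k) = snoc-last k

  snoc-all : ∀ (P : Row → Set) k {G g} → (∀ {i} → i < k → P (G i)) → P g →
             ∀ {i} → i < suc k → P (snoc k G g i)
  snoc-all P zero    PG Pg _               = Pg
  snoc-all P (suc k) PG Pg {zero}  _       = PG (s≤s z≤n)
  snoc-all P (suc k) PG Pg {suc i} (s≤s i<) = snoc-all P k (PG ∘ s≤s) Pg i<

  snoc-sum : ∀ k (F : ℕ → Row → ℕ) {G g} →
             sumBelow (suc k) (λ i → F i (snoc k G g i)) ≡ sumBelow k (λ i → F i (G i)) + F k g
  snoc-sum zero    F {g = g} = +-identityʳ (F 0 g)
  snoc-sum (suc k) F {G}     =
    trans (cong (F 0 (G 0) +_) (snoc-sum k (F ∘ suc))) (sym (+-assoc (F 0 (G 0)) _ _))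

  frame : Row → Row → ℕ → Rows → Rows
  frame f g k G zero    = f
  frame f g k G (suc i) = snoc k G g i

  frame-sum : ∀ k (F : ℕ → Row → ℕ) {f g G} →
              sumBelow (2 + k) (λ i → F i (frame f g k G i))
                ≡ F 0 f + (sumBelow k (λ i → F (suc i) (G i)) + F (suc k) g)
  frame-sum k F {f} = cong (F 0 f +_) (snoc-sum k (F ∘ suc))

  frame-rows : ∀ {f g k G} → IsRow f → IsRow g → (∀ {i} → i < k → IsRow (G i)) →
               ∀ {i} → i < 2 + k → IsRow (frame f g k G i)
  frame-rows         f-row g-row G-rows {zero}  _         = f-row
  frame-rows {k = k} f-row g-row G-rows {suc i} (s≤s i<) = snoc-all IsRow k G-rows g-row i<

  frame-symmetric : ∀ {f g k G} → Dual f g → Dual g f → (∀ {i} → i < k → Dual (G i) (G (k ∸ suc i))) →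
                    ∀ {i} → i < 2 + k → Dual (frame f g k G i) (frame f g k G ((2 + k) ∸ suc i))
  frame-symmetric {f} {g} {k} {G} fg gf G-sym {zero} _ = subst (Dual f) (sym (snoc-last k)) fg
  frame-symmetric {f} {g} {k} {G} fg gf G-sym {suc i} (s≤s (s≤s i≤k)) with m≤n⇒m<n∨m≡n i≤k
  ... | inj₁ i<k = subst₂ Dual (sym (snoc-< k i<k)) (sym partner) (G-sym i<k)
    where
    partner : frame f g k G (k ∸ i) ≡ G (k ∸ suc i)
    partner = trans (cong (frame f g k G) (+-∸-assoc 1 i<k))
                    (snoc-< k (∸-monoʳ-< (s≤s z≤n) i<k))
  ... | inj₂ refl = subst₂ Dual (sym (snoc-last k)) (cong (frame f g k G) (sym (n∸n≡0 k))) gf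

  rotate-shift : ∀ c t j → rotate (c + t) (j % N) ≡ rotate t ((c + j) % N)
  rotate-shift c t j = begin
    (j % N + (c + t)) % N ≡⟨ [m%n+k]%n≡[m+k]%n j (c + t) N ⟩
    (j + (c + t)) % N     ≡⟨ cong (_% N) (lemma c t j) ⟩
    (c + j + t) % N       ≡⟨ [m%n+k]%n≡[m+k]%n (c + j) t N ⟨
    ((c + j) % N + t) % N ∎
    where
    lemma : ∀ c t j → j + (c + t) ≡ c + j + t
    lemma = solve-∀

  +-reflect-≡ : ∀ {x y} → x ≡ y → y ≤ top → x + reflect y ≡ top
  +-reflect-≡ refl = +-reflect

  reflect-+-≡ : ∀ {x y} → x ≡ y → y ≤ top → reflect x + y ≡ top
  reflect-+-≡ {x} {y} refl y≤ = trans (+-comm (reflect x) x) (+-reflect y≤)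

  module Layer (k : ℕ) {G : Rows} (G-kotzig : IsKotzig k G) where

    open IsKotzig G-kotzig

    -- s − t = k + 2 lines up row 0 with row k + 2 and row 1 with row k + 3 along every
    -- diagonal, while s + t ≡ 0 (mod n) makes the outer rows dual to each other.
    t s : ℕ
    t = (2 + k) * m
    s = (2 + k) + t

    s+t≡ : s + t ≡ (2 + k) * N
    s+t≡ = lemma k m
      where
      lemma : ∀ k m → (2 + k) + (2 + k) * m + (2 + k) * m ≡ (2 + k) * suc (m + m)
      lemma = solve-∀

    t+s≡ : t + s ≡ (2 + k) * N
    t+s≡ = trans (+-comm t s) s+t≡

    core : Rows
    core = frame (reflect ∘ rotate s) (reflect ∘ rotate t) k G

    layer : Rows
    layer = frame (rotate s) (rotate t) (2 + k) core

    layer-sum : ∀ (F : ℕ → Row → ℕ) →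
      sumBelow (4 + k) (λ i → F i (layer i))
        ≡ F 0 (rotate s) + ((F 1 (reflect ∘ rotate s) + (sumBelow k (λ i → F (2 + i) (G i))
                                 + F (2 + k) (reflect ∘ rotate t))) + F (3 + k) (rotate t))
    layer-sum F =
      trans (frame-sum (2 + k) F {G = core})
            (cong (λ z → F 0 (rotate s) + (z + F (3 + k) (rotate t))) (frame-sum k (F ∘ suc) {G = G}))

    sum-pairs : ∀ A B C D E → A + B ≡ top → D + E ≡ top → C ≡ k * m →
                A + ((B + (C + D)) + E) ≡ (4 + k) * m
    sum-pairs A B C D E A+B D+E C≡ = begin
      A + ((B + (C + D)) + E) ≡⟨ lemma₁ A B C D E ⟩
      (A + B) + C + (D + E)   ≡⟨ cong₂ (λ x y → x + C + y) A+B D+E ⟩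
      top + C + top           ≡⟨ cong (λ x → top + x + top) C≡ ⟩
      top + k * m + top       ≡⟨ lemma₂ k m ⟩
      (4 + k) * m             ∎
      where
      lemma₁ : ∀ A B C D E → A + ((B + (C + D)) + E) ≡ (A + B) + C + (D + E)
      lemma₁ = solve-∀
      lemma₂ : ∀ k m → (m + m) + k * m + (m + m) ≡ (4 + k) * m
      lemma₂ = solve-∀

    sum-crossed-pairs : ∀ A B C D E → A + D ≡ top → B + E ≡ top → C ≡ k * m →
                        A + ((B + (C + D)) + E) ≡ (4 + k) * m
    sum-crossed-pairs A B C D E A+D B+E C≡ =
      trans (lemma A B C D E) (sum-pairs A D C B E A+D B+E C≡)
      where
      lemma : ∀ A B C D E → A + ((B + (C + D)) + E) ≡ A + ((D + (C + B)) + E)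
      lemma = solve-∀

    layer-rows : ∀ {i} → i < 4 + k → IsRow (layer i)
    layer-rows = frame-rows {G = core} (rotate-row s) (rotate-row t)
      (frame-rows {G = G} (∘-row reflect-row (rotate-row s)) (∘-row reflect-row (rotate-row t)) rows)

    layer-columns : ∀ {x} → x ≤ top → sumBelow (4 + k) (λ i → layer i x) ≡ (4 + k) * m
    layer-columns {x} x≤ = trans (layer-sum (λ _ f → f x))
      (sum-pairs (rotate s x) (reflect (rotate s x)) _ (reflect (rotate t x)) (rotate t x)
                 (+-reflect-≡ refl (%N≤top (x + s))) (reflect-+-≡ refl (%N≤top (x + t))) (columns x≤))

    layer-diagonals : ∀ j → sumBelow (4 + k) (λ i → layer i ((i + j) % N)) ≡ (4 + k) * m
    layer-diagonals j = trans (layer-sum (λ i f → f ((i + j) % N)))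
      (sum-crossed-pairs (rotate s (j % N)) (reflect (rotate s ((1 + j) % N))) _
                         (reflect (rotate t ((2 + k + j) % N))) (rotate t ((3 + k + j) % N))
        (+-reflect-≡ (rotate-shift (2 + k) t j) (%N≤top ((2 + k + j) % N + t)))
        (reflect-+-≡ (trans (rotate-shift (2 + k) t (1 + j)) (cong (λ z → rotate t (z % N)) (+-suc (2 + k) j)))
                     (%N≤top ((3 + k + j) % N + t)))
        (trans (sumBelow-cong k (λ i → cong (λ z → G i (z % N)) (lemma i j))) (diagonals (2 + j))))
      where
      lemma : ∀ i j → 2 + i + j ≡ i + (2 + j)
      lemma = solve-∀

    layer-symmetric : ∀ {i} → i < 4 + k → Dual (layer i) (layer ((4 + k) ∸ suc i))
    layer-symmetric = frame-symmetric {G = core} outer outer′ (frame-symmetric {G = G} inner inner′ symmetric)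
      where
      outer : Dual (rotate s) (rotate t)
      outer = rotate-Dual s t (2 + k) s+t≡
      outer′ : Dual (rotate t) (rotate s)
      outer′ = rotate-Dual t s (2 + k) t+s≡
      inner : Dual (reflect ∘ rotate s) (reflect ∘ rotate t)
      inner = reflect-Dual (rotate s) (rotate t) outer
      inner′ : Dual (reflect ∘ rotate t) (reflect ∘ rotate s)
      inner′ = reflect-Dual (rotate t) (rotate s) outer′

    layer-kotzig : IsKotzig (4 + k) layer
    layer-kotzig = record
      { rows      = layer-rows
      ; columns   = layer-columns
      ; diagonals = layer-diagonals
      ; symmetric = layer-symmetric
      }

  triple : Rows
  triple zero          = dual (zigzag m)
  triple (suc zero)    = id
  triple (suc (suc _)) = zigzag m

  triple-column : ∀ {x} → x ≤ top → sumBelow 3 (λ i → triple i x) ≡ 3 * m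
  triple-column {x} x≤ = +-cancelʳ-≡ (A + m) _ _ (begin
    dual (zigzag m) x + (x + (zigzag m x + 0)) + (A + m) ≡⟨ lemma₁ (dual (zigzag m) x) x (zigzag m x) A m ⟩
    (dual (zigzag m) x + A) + (zigzag m x + x + m)      ≡⟨ cong₂ _+_ (dual-Dualˡ zigzag-row x≤) (zigzag-reflect m x≤) ⟩
    top + (A + top)                                     ≡⟨ lemma₂ A m ⟩
    3 * m + (A + m)                                     ∎)
    where
    A = zigzag m (reflect x)
    lemma₁ : ∀ d x z a m → d + (x + (z + 0)) + (a + m) ≡ (d + a) + (z + x + m)
    lemma₁ = solve-∀
    lemma₂ : ∀ a m → (m + m) + (a + (m + m)) ≡ 3 * m + (a + m)
    lemma₂ = solve-∀

  triple-diagonal-at : ∀ {r} → r ≤ top →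
    dual (zigzag m) r + ((1 + r) % N + (zigzag m ((2 + r) % N) + 0)) ≡ 3 * m
  triple-diagonal-at {r} r≤ with m≤n⇒m<n∨m≡n r≤
  ... | inj₂ refl = begin
    dual (zigzag m) top + ((1 + top) % N + (zigzag m ((2 + top) % N) + 0))
      ≡⟨ cong₂ (λ a b → reflect (zigzag m a) + (b + (zigzag m ((2 + top) % N) + 0))) (n∸n≡0 top) (n%n≡0 N) ⟩
    reflect m + (0 + (zigzag m ((2 + top) % N) + 0))
      ≡⟨ cong₂ (λ a b → a + (b + 0)) (m+n∸n≡m m m) (trans (cong (zigzag m) ([m+n]%n≡m%n 1 N)) (zigzag-1%n m)) ⟩
    m + (top + 0)
      ≡⟨ lemma m ⟩
    3 * m ∎
    where
    lemma : ∀ m → m + ((m + m) + 0) ≡ 3 * m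
    lemma = solve-∀
  ... | inj₁ r<top with m≤n⇒m<n∨m≡n r<top
  ... | inj₂ 1+r≡top = begin
    reflect (zigzag m (reflect r)) + ((1 + r) % N + (zigzag m ((2 + r) % N) + 0))
      ≡⟨ cong (λ a → reflect (zigzag m a) + ((1 + r) % N + (zigzag m ((2 + r) % N) + 0)))
              (m+n≡o⇒o∸m≡n r (trans (+-comm r 1) 1+r≡top)) ⟩
    reflect top + ((1 + r) % N + (zigzag m ((2 + r) % N) + 0))
      ≡⟨ cong₂ (λ a b → a + (b + (zigzag m ((2 + r) % N) + 0))) (n∸n≡0 top)
               (trans (cong (_% N) 1+r≡top) (%N-small ≤-refl)) ⟩
    0 + (top + (zigzag m ((2 + r) % N) + 0))
      ≡⟨ cong (λ a → top + (zigzag m a + 0)) (trans (cong (λ a → suc a % N) 1+r≡top) (n%n≡0 N)) ⟩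
    top + (m + 0)
      ≡⟨ lemma m ⟩
    3 * m ∎
    where
    lemma : ∀ m → (m + m) + (m + 0) ≡ 3 * m
    lemma = solve-∀
  ... | inj₁ 2+r≤top = begin
    dual (zigzag m) r + ((1 + r) % N + (zigzag m ((2 + r) % N) + 0))
      ≡⟨ cong₂ (λ a b → dual (zigzag m) r + (a + (zigzag m b + 0))) (%N-small r<top) (%N-small 2+r≤top) ⟩
    dual (zigzag m) r + (suc r + (zigzag m r ∸ 1 + 0))
      ≡⟨ cong (dual (zigzag m) r +_) (step r (zigzag-positive m 2+r≤top)) ⟩
    dual (zigzag m) r + (r + (zigzag m r + 0))
      ≡⟨ triple-column r≤ ⟩
    3 * m ∎
    where
    step : ∀ r {a} → 0 < a → suc r + (a ∸ 1 + 0) ≡ r + (a + 0)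
    step r {a} 0<a =
      trans (sym (+-suc r (a ∸ 1 + 0))) (cong (λ b → r + (b + 0)) (trans (+-comm 1 (a ∸ 1)) (m∸n+n≡m 0<a)))

  triple-diagonal : ∀ j → sumBelow 3 (λ i → triple i ((i + j) % N)) ≡ 3 * m
  triple-diagonal j = begin
    dual (zigzag m) (j % N) + ((1 + j) % N + (zigzag m ((2 + j) % N) + 0))
      ≡⟨ cong₂ (λ a b → dual (zigzag m) (j % N) + (a + (zigzag m b + 0)))
               ([k+m%n]%n≡[k+m]%n 1 j N) ([k+m%n]%n≡[k+m]%n 2 j N) ⟨
    dual (zigzag m) (j % N) + ((1 + j % N) % N + (zigzag m ((2 + j % N) % N) + 0))
      ≡⟨ triple-diagonal-at (%N≤top j) ⟩
    3 * m ∎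

  triple-rows : ∀ {i} → i < 3 → IsRow (triple i)
  triple-rows {0} _ = dual-row zigzag-row
  triple-rows {1} _ = id-row
  triple-rows {2} _ = zigzag-row
  triple-rows {suc (suc (suc _))} (s≤s (s≤s (s≤s ())))

  triple-symmetric : ∀ {i} → i < 3 → Dual (triple i) (triple (3 ∸ suc i))
  triple-symmetric {0} _ = dual-Dualˡ zigzag-row
  triple-symmetric {1} _ = id-self-dual
  triple-symmetric {2} _ = dual-Dualʳ zigzag-row
  triple-symmetric {suc (suc (suc _))} (s≤s (s≤s (s≤s ())))

  triple-kotzig : IsKotzig 3 triple
  triple-kotzig = record
    { rows      = triple-rows
    ; columns   = triple-column
    ; diagonals = triple-diagonal
    ; symmetric = triple-symmetric
    }

  quintuple : Rows
  quintuple zero                      = dual (zigzag m)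
  quintuple (suc zero)                = id
  quintuple (suc (suc zero))          = reflect
  quintuple (suc (suc (suc zero)))    = id
  quintuple (suc (suc (suc (suc _)))) = zigzag m

  quintuple-column : ∀ {x} → x ≤ top → sumBelow 5 (λ i → quintuple i x) ≡ 5 * m
  quintuple-column {x} x≤ = begin
    d + (x + (reflect x + (x + (z + 0)))) ≡⟨ lemma₁ d x (reflect x) z ⟩
    (d + (x + (z + 0))) + (x + reflect x) ≡⟨ cong₂ _+_ (triple-column x≤) (+-reflect x≤) ⟩
    3 * m + top                           ≡⟨ lemma₂ m ⟩
    5 * m                                 ∎
    where
    d = dual (zigzag m) x
    z = zigzag m x
    lemma₁ : ∀ d x r z → d + (x + (r + (x + (z + 0)))) ≡ (d + (x + (z + 0))) + (x + r)
    lemma₁ = solve-∀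
    lemma₂ : ∀ m → 3 * m + (m + m) ≡ 5 * m
    lemma₂ = solve-∀

  -- A diagonal of quintuple is made of two diagonals of triple, starting at j and 2 + j, with
  -- their shared entry exchanged: one column of triple settles the difference.
  quintuple-diagonal : ∀ j → sumBelow 5 (λ i → quintuple i ((i + j) % N)) ≡ 5 * m
  quintuple-diagonal j = +-cancelʳ-≡ (3 * m) _ _ (begin
    sumBelow 5 (λ i → quintuple i ((i + j) % N)) + 3 * m
      ≡⟨ cong (sumBelow 5 (λ i → quintuple i ((i + j) % N)) +_) (triple-column (%N≤top (2 + j))) ⟨
    sumBelow 5 (λ i → quintuple i ((i + j) % N)) + sumBelow 3 (λ i → triple i y)
      ≡⟨ lemma₁ (dual (zigzag m) (j % N)) ((1 + j) % N) (reflect y) ((3 + j) % N) (zigzag m ((4 + j) % N))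
                (dual (zigzag m) y) y (zigzag m y) ⟩
    sumBelow 3 (λ i → triple i ((i + j) % N)) + sumBelow 3 (λ i → triple i ((i + (2 + j)) % N)) + (y + reflect y)
      ≡⟨ cong₂ _+_ (cong₂ _+_ (triple-diagonal j) (triple-diagonal (2 + j))) (+-reflect (%N≤top (2 + j))) ⟩
    3 * m + 3 * m + top
      ≡⟨ lemma₂ m ⟩
    5 * m + 3 * m ∎)
    where
    y = (2 + j) % N
    lemma₁ : ∀ a b c d e f g h →
      a + (b + (c + (d + (e + 0)))) + (f + (g + (h + 0))) ≡ a + (b + (h + 0)) + (f + (d + (e + 0))) + (g + c)
    lemma₁ = solve-∀
    lemma₂ : ∀ m → 3 * m + 3 * m + (m + m) ≡ 5 * m + 3 * m
    lemma₂ = solve-∀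

  quintuple-rows : ∀ {i} → i < 5 → IsRow (quintuple i)
  quintuple-rows {0} _ = dual-row zigzag-row
  quintuple-rows {1} _ = id-row
  quintuple-rows {2} _ = reflect-row
  quintuple-rows {3} _ = id-row
  quintuple-rows {4} _ = zigzag-row
  quintuple-rows {suc (suc (suc (suc (suc _))))} (s≤s (s≤s (s≤s (s≤s (s≤s ())))))

  quintuple-symmetric : ∀ {i} → i < 5 → Dual (quintuple i) (quintuple (5 ∸ suc i))
  quintuple-symmetric {0} _ = dual-Dualˡ zigzag-row
  quintuple-symmetric {1} _ = id-self-dual
  quintuple-symmetric {2} _ = reflect-self-dual
  quintuple-symmetric {3} _ = id-self-dual
  quintuple-symmetric {4} _ = dual-Dualʳ zigzag-row
  quintuple-symmetric {suc (suc (suc (suc (suc _))))} (s≤s (s≤s (s≤s (s≤s (s≤s ())))))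

  quintuple-kotzig : IsKotzig 5 quintuple
  quintuple-kotzig = record
    { rows      = quintuple-rows
    ; columns   = quintuple-column
    ; diagonals = quintuple-diagonal
    ; symmetric = quintuple-symmetric
    }

  sextuple : Rows
  sextuple (suc (suc (suc i))) = triple i
  sextuple i                   = triple i

  sextuple-rows : ∀ {i} → i < 6 → IsRow (sextuple i)
  sextuple-rows {0} _ = dual-row zigzag-row
  sextuple-rows {1} _ = id-row
  sextuple-rows {2} _ = zigzag-row
  sextuple-rows {3} _ = dual-row zigzag-row
  sextuple-rows {4} _ = id-row
  sextuple-rows {5} _ = zigzag-row
  sextuple-rows {suc (suc (suc (suc (suc (suc _)))))} (s≤s (s≤s (s≤s (s≤s (s≤s (s≤s ()))))))

  sextuple-symmetric : ∀ {i} → i < 6 → Dual (sextuple i) (sextuple (6 ∸ suc i))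
  sextuple-symmetric {0} _ = dual-Dualˡ zigzag-row
  sextuple-symmetric {1} _ = id-self-dual
  sextuple-symmetric {2} _ = dual-Dualʳ zigzag-row
  sextuple-symmetric {3} _ = dual-Dualˡ zigzag-row
  sextuple-symmetric {4} _ = id-self-dual
  sextuple-symmetric {5} _ = dual-Dualʳ zigzag-row
  sextuple-symmetric {suc (suc (suc (suc (suc (suc _)))))} (s≤s (s≤s (s≤s (s≤s (s≤s (s≤s ()))))))

  sextuple-column : ∀ {x} → x ≤ top → sumBelow 6 (λ i → sextuple i x) ≡ 6 * m
  sextuple-column {x} x≤ = begin
    sumBelow 6 (λ i → sextuple i x)                       ≡⟨ sumBelow-+ 3 3 (λ i → sextuple i x) ⟩
    sumBelow 3 (λ i → triple i x) + sumBelow 3 (λ i → triple i x) ≡⟨ cong₂ _+_ (triple-column x≤) (triple-column x≤) ⟩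
    3 * m + 3 * m                                         ≡⟨ lemma m ⟩
    6 * m                                                 ∎
    where
    lemma : ∀ m → 3 * m + 3 * m ≡ 6 * m
    lemma = solve-∀

  sextuple-diagonal : ∀ j → sumBelow 6 (λ i → sextuple i ((i + j) % N)) ≡ 6 * m
  sextuple-diagonal j = begin
    sumBelow 6 (λ i → sextuple i ((i + j) % N))
      ≡⟨ sumBelow-+ 3 3 (λ i → sextuple i ((i + j) % N)) ⟩
    sumBelow 3 (λ i → triple i ((i + j) % N)) + sumBelow 3 (λ i → triple i ((3 + i + j) % N))
      ≡⟨ cong (sumBelow 3 (λ i → triple i ((i + j) % N)) +_)
              (sumBelow-cong 3 (λ i → cong (λ a → triple i (a % N)) (lemma₁ i j))) ⟩
    sumBelow 3 (λ i → triple i ((i + j) % N)) + sumBelow 3 (λ i → triple i ((i + (3 + j)) % N))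
      ≡⟨ cong₂ _+_ (triple-diagonal j) (triple-diagonal (3 + j)) ⟩
    3 * m + 3 * m
      ≡⟨ lemma₂ m ⟩
    6 * m ∎
    where
    lemma₁ : ∀ i j → 3 + i + j ≡ i + (3 + j)
    lemma₁ = solve-∀
    lemma₂ : ∀ m → 3 * m + 3 * m ≡ 6 * m
    lemma₂ = solve-∀

  sextuple-kotzig : IsKotzig 6 sextuple
  sextuple-kotzig = record
    { rows      = sextuple-rows
    ; columns   = sextuple-column
    ; diagonals = sextuple-diagonal
    ; symmetric = sextuple-symmetric
    }

  empty-kotzig : IsKotzig 0 (λ _ → id)
  empty-kotzig = record { rows = λ () ; columns = λ _ → refl ; diagonals = λ _ → refl ; symmetric = λ () }

  kotzigArray : ∀ k → Σ Rows (IsKotzig (3 + k))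
  kotzigArray 0 = triple , triple-kotzig
  kotzigArray 1 = Layer.layer 0 empty-kotzig , Layer.layer-kotzig 0 empty-kotzig
  kotzigArray 2 = quintuple , quintuple-kotzig
  kotzigArray 3 = sextuple , sextuple-kotzig
  kotzigArray (suc (suc (suc (suc k)))) = Layer.layer (3 + k) K , Layer.layer-kotzig (3 + k) K
    where
    K = proj₂ (kotzigArray k)

  toArray : ∀ d → Rows → Array d N
  toArray d G i j = suc (G (toℕ i) (toℕ j))

  row-permutation : ∀ {f} → IsRow f → Σ (Permutation′ N) (λ π → ∀ j → suc (f (toℕ j)) ≡ suc (toℕ (π ⟨$⟩ʳ j)))
  row-permutation {f} f-row =
    π , λ j → cong suc (sym (trans (cong toℕ (π≗f′ j)) (toℕ-fromℕ< (f<N j))))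
    where
    f<N : ∀ j → f (toℕ j) < N
    f<N j = s≤s (bounded f-row (≤-pred (toℕ<n j)))
    f′ : Fin N → Fin N
    f′ j = fromℕ< (f<N j)
    f′-injective : Injective _≡_ _≡_ f′
    f′-injective {i} {j} eq = toℕ-injective (injective f-row (≤-pred (toℕ<n i)) (≤-pred (toℕ<n j))
      (trans (sym (toℕ-fromℕ< (f<N i))) (trans (cong toℕ eq) (toℕ-fromℕ< (f<N j)))))
    π = proj₁ (injective⇒permutation f′-injective)
    π≗f′ = proj₂ (injective⇒permutation f′-injective)

  isSymmetricDiagonalKotzig : ∀ {d G} → IsKotzig d G → IsSymmetricDiagonalKotzig d N (toArray d G)
  isSymmetricDiagonalKotzig {d} {G} K =
    (λ i → row-permutation (rows (toℕ<n i))) ,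
    (λ j k → trans (column-sum j) (sym (column-sum k))) ,
    (λ j k → trans (diagonal-sum j) (sym (diagonal-sum k))) ,
    symmetric′
    where
    open IsKotzig K
    column-sum : ∀ j → Σ[ d ] (λ i → toArray d G i j) ≡ d + d * m
    column-sum j = trans (Σ[]-toℕ d (λ i → suc (G i (toℕ j))) (λ _ → refl))
                         (trans (sumBelow-suc d _) (cong (d +_) (columns (≤-pred (toℕ<n j)))))
    diagonal-sum : ∀ j → Σ[ d ] (λ i → toArray d G i (diagCol N (toℕ i) (toℕ j))) ≡ d + d * m
    diagonal-sum j = trans (Σ[]-toℕ d (λ i → suc (G i ((i + suc (toℕ j)) % N)))
                              (λ i → cong (λ x → suc (G (toℕ i) x))
                                (trans (toℕ-fromℕ< _) (cong (_% N) (lemma (toℕ j) (toℕ i))))))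
                           (trans (sumBelow-suc d _) (cong (d +_) (diagonals (suc (toℕ j)))))
      where
      lemma : ∀ j i → j + i + 1 ≡ i + suc j
      lemma = solve-∀
    symmetric′ : Symmetric d N (toArray d G)
    symmetric′ i j = begin
      suc (G (toℕ i) (toℕ j)) + suc (G (toℕ (opposite i)) (toℕ (opposite j)))
        ≡⟨ cong₂ (λ a b → suc (G (toℕ i) (toℕ j)) + suc (G a b)) (opposite-prop i) (opposite-prop j) ⟩
      suc (G (toℕ i) (toℕ j)) + suc (G (d ∸ suc (toℕ i)) (reflect (toℕ j)))
        ≡⟨ cong suc (+-suc _ _) ⟩
      suc (suc (G (toℕ i) (toℕ j) + G (d ∸ suc (toℕ i)) (reflect (toℕ j))))
        ≡⟨ cong (suc ∘ suc) (symmetric (toℕ<n i) (≤-pred (toℕ<n j))) ⟩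
      suc N
        ≡⟨ +-comm 1 N ⟩
      N + 1 ∎

odd⇒1+double : ∀ {n} → n % 2 ≡ 1 → Σ ℕ (λ m → n ≡ suc (m + m))
odd⇒1+double {n} n%2≡1 = n / 2 , (begin
  n                 ≡⟨ m≡m%n+[m/n]*n n 2 ⟩
  n % 2 + n / 2 * 2 ≡⟨ cong₂ _+_ n%2≡1 (lemma (n / 2)) ⟩
  suc (n / 2 + n / 2) ∎)
  where
  lemma : ∀ x → x * 2 ≡ x + x
  lemma = solve-∀

theorem3p4 : (n d : ℕ) .{{nz : NonZero n}} → n % 2 ≡ 1 → 3 ≤ n → 3 ≤ d → d ≤ n →
    Σ (Array d n) (λ A → IsSymmetricDiagonalKotzig d n A)
theorem3p4 n d n%2≡1 _ 3≤d _
  with m , refl ← odd⇒1+double {n} n%2≡1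
     | k , refl ← m≤n⇒∃[o]m+o≡n {3} {d} 3≤d =
  toArray (3 + k) (proj₁ (kotzigArray k)) , isSymmetricDiagonalKotzig (proj₂ (kotzigArray k))
  where open Construction m
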